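{- For every integer $n \geq 3$, the complete sun graph $S_n$ satisfies $\beta(S_n)+\beta(\overline{S_n}) = 2n$ and $\beta(S_n)\cdot\beta(\overline{S_n}) = n^2$.
   Context: All graphs are simple and finite. For $n \ge 3$, the complete sun $S_n$ is the graph on $2n$ vertices whose vertex set is partitioned into $U=\{u_1,\dots,u_n\}$ and $W=\{w_1,\dots,w_n\}$, where $U$ is an independent set, $W$ induces a complete graph $K_n$, and $u_i$ is adjacent to $w_j$ if and only if $j=i$ or $j \equiv i+1 \pmod n$. For a graph $G$, $\beta(G)$ denotes the vertex cover number of $G$: the minimum cardinality of a set $S$ of vertices such that every edge of $G$ has at least one end in $S$. $\overline{G}$ denotes the complement of $G$: the graph on the same vertex set in which two distinct vertices are adjacent if and only if they are not adjacent in $G$. -}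

module Defs where

open import Data.Nat using (ℕ; suc; _+_; _≤_; _%_; NonZero)
open import Data.Fin using (Fin; toℕ; splitAt)
open import Data.Sum using (_⊎_; inj₁; inj₂)
open import Data.Product using (_×_; ∃)
open import Data.Empty using (⊥)
open import Data.Unit using (⊤)
open import Data.List using (List; length)
open import Data.List.Membership.Propositional using (_∈_)
open import Data.List.Relation.Unary.Unique.Propositional using (Unique)
open import Relation.Binary.PropositionalEquality using (_≡_)
open import Relation.Nullary using (¬_)

record Graph (m : ℕ) : Set₁ where
  field
    Adj     : Fin m → Fin m → Set
    irrefl  : ∀ x → ¬ Adj x x
    sym     : ∀ x y → Adj x y → Adj y x

complement : ∀ {m} → Graph m → Graph m
complement {m} G = record
  { Adj    = λ x y → ¬ (x ≡ y) × ¬ Adj x y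
  ; irrefl = λ x p → Data.Product.proj₁ p _≡_.refl
  ; sym    = λ x y p → (λ e → Data.Product.proj₁ p (Relation.Binary.PropositionalEquality.sym e))
                     , (λ a → Data.Product.proj₂ p (Graph.sym G y x a))
  }
  where open Graph G using (Adj)
        import Data.Product
        import Relation.Binary.PropositionalEquality
        open Data.Product using (_,_)

IsVertexCover : ∀ {m} → Graph m → List (Fin m) → Set
IsVertexCover G S = ∀ x y → Graph.Adj G x y → (x ∈ S) ⊎ (y ∈ S)

VertexCoverNumber : ∀ {m} → Graph m → ℕ → Set
VertexCoverNumber G k =
  (∃ λ S → Unique S × IsVertexCover G S × length S ≡ k)
  × (∀ S → Unique S → IsVertexCover G S → k ≤ length S)

-- Complete sun S_n on Fin (n + n): index i < n is u_(i+1), index n + j is w_(j+1).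
-- With 0-based indices: u_i ~ w_j iff j = i or j ≡ i+1 (mod n); W is a clique.
-- u_i ~ w_j iff j = i or j ≡ i + 1 (mod n), written without _%_:
-- j = i, or j = i + 1, or (i + 1 = n and j = 0).
SunUW : (n : ℕ) → Fin n → Fin n → Set
SunUW n i j = (toℕ j ≡ toℕ i) ⊎ (toℕ j ≡ suc (toℕ i)) ⊎ (suc (toℕ i) ≡ n × toℕ j ≡ 0)

SunAdj : (n : ℕ) → Fin n ⊎ Fin n → Fin n ⊎ Fin n → Set
SunAdj n (inj₁ i) (inj₁ j) = ⊥
SunAdj n (inj₁ i) (inj₂ j) = SunUW n i j
SunAdj n (inj₂ i) (inj₁ j) = SunUW n j i
SunAdj n (inj₂ i) (inj₂ j) = ¬ (i ≡ j)

completeSun : (n : ℕ) → Graph (n + n)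
completeSun n = record
  { Adj    = λ x y → SunAdj n (splitAt n x) (splitAt n y)
  ; irrefl = λ x → irr (splitAt n x)
  ; sym    = λ x y → sy (splitAt n x) (splitAt n y)
  }
  where
    irr : ∀ a → ¬ SunAdj n a a
    irr (inj₁ i) ()
    irr (inj₂ i) p = p _≡_.refl
    sy : ∀ a b → SunAdj n a b → SunAdj n b a
    sy (inj₁ i) (inj₂ j) p = p
    sy (inj₂ i) (inj₁ j) p = p
    sy (inj₂ i) (inj₂ j) p = λ e → p (Relation.Binary.PropositionalEquality.sym e)
      where import Relation.Binary.PropositionalEquality

-- The complete sun S_n and its complement both have vertex cover number n
-- (for n ≥ 3), so β(S_n) + β(S̄_n) = 2n and β(S_n) · β(S̄_n) = n².
--
-- Both values are certified in the same König-style way: a vertex cover of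
-- size k together with a matching of size k pins the vertex cover number to
-- k, since every cover must contain a distinct endpoint of each matching
-- edge.
module Submission where

open import Defs
open import Data.Nat using (ℕ; suc; s≤s; _+_; _*_; _≤_; _≤?_)
open import Data.Nat.Properties
  using (≰⇒>; +-identityʳ; 0≢1+n; 1+n≢n; <⇒≢; m<n⇒m<1+n; n<1+n; suc-injective)
open import Data.Fin using (Fin; splitAt; _↑ˡ_; _↑ʳ_; fromℕ; inject₁)
import Data.Fin.Properties as Fin
open import Data.Sum using (inj₁; inj₂)
open import Data.Product using (_×_; ∃₂; _,_)
open import Data.List using (List; length; map; allFin; lookup)
open import Data.List.Properties using (length-map; length-tabulate)
open import Data.List.Membership.Propositional using (_∈_)
open import Data.List.Membership.Propositional.Properties using (∈-map⁺; ∈-allFin)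
open import Data.List.Relation.Unary.Any using (index)
open import Data.List.Relation.Unary.Any.Properties using (lookup-index)
open import Data.List.Relation.Unary.Unique.Propositional using (Unique)
import Data.List.Relation.Unary.Unique.Propositional.Properties as Unique
open import Data.Empty using (⊥-elim)
open import Function using (id)
open import Function.Definitions using (Injective)
open import Relation.Nullary using (¬_; yes; no)
open import Relation.Binary.PropositionalEquality
  using (_≡_; _≢_; refl; sym; trans; cong; cong₂; subst)

injection-bound : ∀ {k m} (S : List (Fin m)) (f : Fin k → Fin m) →
                  Injective _≡_ _≡_ f → (∀ j → f j ∈ S) → k ≤ length S
injection-bound {k} S f f-inj f∈S with k ≤? length S
... | yes k≤|S| = k≤|S|
... | no k≰|S| with Fin.pigeonhole (≰⇒> k≰|S|) (λ j → index (f∈S j))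
...   | i , j , i<j , same-index = ⊥-elim (Fin.<-irrefl (f-inj fi≡fj) i<j)
  where
  fi≡fj : f i ≡ f j
  fi≡fj = trans (lookup-index (f∈S i))
                (trans (cong (lookup S) same-index) (sym (lookup-index (f∈S j))))

record Matching {m} (G : Graph m) (k : ℕ) : Set where
  field
    left right      : Fin k → Fin m
    left-injective  : Injective _≡_ _≡_ left
    right-injective : Injective _≡_ _≡_ right
    left≢right      : ∀ i j → left i ≢ right j
    edge            : ∀ j → Graph.Adj G (left j) (right j)

-- Every vertex cover contains an endpoint of each matching edge, and these
-- endpoints are distinct; hence a matching of size k forces covers of size ≥ k.
matching-bound : ∀ {m k} {G : Graph m} → Matching G k →
                 ∀ S → IsVertexCover G S → k ≤ length S
matching-bound {m} {k} {G} M S cover = injection-bound S chosen chosen-injective chosen∈S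
  where
  open Matching M
  open import Data.List.Membership.DecPropositional (Fin._≟_) using (_∈?_)

  chosen : Fin k → Fin m
  chosen j with left j ∈? S
  ... | yes _ = left j
  ... | no  _ = right j

  chosen∈S : ∀ j → chosen j ∈ S
  chosen∈S j with left j ∈? S
  ... | yes l∈S = l∈S
  ... | no  l∉S with cover (left j) (right j) (edge j)
  ...   | inj₁ l∈S = ⊥-elim (l∉S l∈S)
  ...   | inj₂ r∈S = r∈S

  chosen-injective : Injective _≡_ _≡_ chosen
  chosen-injective {i} {j} eq with left i ∈? S | left j ∈? S
  ... | yes _ | yes _ = left-injective eq
  ... | yes _ | no  _ = ⊥-elim (left≢right i j eq)
  ... | no  _ | yes _ = ⊥-elim (left≢right j i (sym eq))
  ... | no  _ | no  _ = right-injective eq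

vertexCoverNumber-certificate :
  ∀ {m k} {G : Graph m} → Matching G k →
  ∀ S → Unique S → IsVertexCover G S → length S ≡ k → VertexCoverNumber G k
vertexCoverNumber-certificate M S unique cover |S|≡k =
  (S , unique , cover , |S|≡k) , λ S′ _ cover′ → matching-bound M S′ cover′

rotateBack : ∀ {m} → Fin (suc m) → Fin (suc m)
rotateBack {m} Fin.zero = fromℕ m
rotateBack (Fin.suc i)  = inject₁ i

rotateBack-injective : ∀ {m} → Injective _≡_ _≡_ (rotateBack {m})
rotateBack-injective {x = Fin.zero}  {Fin.zero}  _  = refl
rotateBack-injective {x = Fin.zero}  {Fin.suc j} eq = ⊥-elim (Fin.fromℕ≢inject₁ eq)
rotateBack-injective {x = Fin.suc i} {Fin.zero}  eq = ⊥-elim (Fin.fromℕ≢inject₁ (sym eq))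
rotateBack-injective {x = Fin.suc i} {Fin.suc j} eq = cong Fin.suc (Fin.inject₁-injective eq)

-- For n ≥ 3, u_i is not adjacent in S_n to w_(i-1): i - 1 is neither i nor
-- i + 1 modulo n.
sun-misses-rotateBack : ∀ k (i : Fin (3 + k)) → ¬ SunUW (3 + k) i (rotateBack i)
sun-misses-rotateBack k Fin.zero rewrite Fin.toℕ-fromℕ (2 + k) = λ
  { (inj₁ ()) ; (inj₂ (inj₁ ())) ; (inj₂ (inj₂ (() , _))) }
sun-misses-rotateBack k (Fin.suc i) rewrite Fin.toℕ-inject₁ i = λ
  { (inj₁ i≡1+i)                → 1+n≢n (sym i≡1+i)
  ; (inj₂ (inj₁ i≡2+i))          → <⇒≢ (m<n⇒m<1+n (n<1+n _)) i≡2+i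
  ; (inj₂ (inj₂ (2+i≡3+k , i≡0))) → 0≢1+n (trans (sym i≡0) (suc-injective (suc-injective 2+i≡3+k)))
  }

module Sun (n : ℕ) where

  u w : Fin n → Fin (n + n)
  u i = i ↑ˡ n
  w j = n ↑ʳ j

  u≢w : ∀ i j → u i ≢ w j
  u≢w i j eq with trans (sym (Fin.splitAt-↑ˡ n i n)) (trans (cong (splitAt n) eq) (Fin.splitAt-↑ʳ n n j))
  ... | ()

  Us Ws : List (Fin (n + n))
  Us = map u (allFin n)
  Ws = map w (allFin n)

  Us-unique : Unique Us
  Us-unique = Unique.map⁺ (Fin.↑ˡ-injective n _ _) (Unique.allFin⁺ n)

  Ws-unique : Unique Ws
  Ws-unique = Unique.map⁺ (Fin.↑ʳ-injective n _ _) (Unique.allFin⁺ n)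

  length-side : (f : Fin n → Fin (n + n)) → length (map f (allFin n)) ≡ n
  length-side f = trans (length-map f (allFin n)) (length-tabulate {n = n} (λ i → i))

  ∈Us : ∀ {x i} → splitAt n x ≡ inj₁ i → x ∈ Us
  ∈Us {i = i} eq = subst (_∈ Us) (Fin.splitAt⁻¹-↑ˡ eq) (∈-map⁺ u (∈-allFin i))

  ∈Ws : ∀ {x j} → splitAt n x ≡ inj₂ j → x ∈ Ws
  ∈Ws {j = j} eq = subst (_∈ Ws) (Fin.splitAt⁻¹-↑ʳ eq) (∈-map⁺ w (∈-allFin j))

  adj-uw : ∀ i j → Graph.Adj (completeSun n) (u i) (w j) ≡ SunUW n i j
  adj-uw i j = cong₂ (SunAdj n) (Fin.splitAt-↑ˡ n i n) (Fin.splitAt-↑ʳ n n j)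

  -- U is independent in S_n, so W covers every edge.
  Ws-cover : IsVertexCover (completeSun n) Ws
  Ws-cover x y xy with splitAt n x in ex | splitAt n y in ey
  ... | inj₁ _ | inj₁ _ = ⊥-elim xy
  ... | _      | inj₂ _ = inj₂ (∈Ws ey)
  ... | inj₂ _ | inj₁ _ = inj₁ (∈Ws ex)

  -- W is a clique in S_n, hence independent in its complement, so U covers S̄_n.
  Us-cover : IsVertexCover (complement (completeSun n)) Us
  Us-cover x y (x≢y , x≁y) with splitAt n x in ex | splitAt n y in ey
  ... | inj₁ _ | _      = inj₁ (∈Us ex)
  ... | inj₂ _ | inj₁ _ = inj₂ (∈Us ey)
  ... | inj₂ i | inj₂ j with i Fin.≟ j
  ...   | no  i≢j  = ⊥-elim (x≁y i≢j)
  ...   | yes refl = ⊥-elim (x≢y (trans (sym (Fin.splitAt⁻¹-↑ʳ ex)) (Fin.splitAt⁻¹-↑ʳ ey)))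

  sun-matching : Matching (completeSun n) n
  sun-matching = record
    { left            = u
    ; right           = w
    ; left-injective  = Fin.↑ˡ-injective n _ _
    ; right-injective = Fin.↑ʳ-injective n _ _
    ; left≢right      = u≢w
    ; edge            = λ j → subst id (sym (adj-uw j j)) (inj₁ refl)
    }

complement-matching : ∀ k → Matching (complement (completeSun (3 + k))) (3 + k)
complement-matching k = record
  { left            = u
  ; right           = λ i → w (rotateBack i)
  ; left-injective  = Fin.↑ˡ-injective n _ _
  ; right-injective = λ eq → rotateBack-injective (Fin.↑ʳ-injective n _ _ eq)
  ; left≢right      = λ i j → u≢w i (rotateBack j)
  ; edge            = λ i → u≢w i (rotateBack i)
                          , λ adj → sun-misses-rotateBack k i (subst id (adj-uw i (rotateBack i)) adj)
  }
  where
  n = 3 + k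
  open Sun n

mainTheorem6 : (n : ℕ) → 3 ≤ n →
    ∃₂ λ b b̄ → VertexCoverNumber (completeSun n) b
    × VertexCoverNumber (complement (completeSun n)) b̄
    × (b + b̄ ≡ 2 * n) × (b * b̄ ≡ n * n)
mainTheorem6 n@(suc (suc (suc k))) (s≤s (s≤s (s≤s _))) =
  n , n
  , vertexCoverNumber-certificate sun-matching Ws Ws-unique Ws-cover (length-side w)
  , vertexCoverNumber-certificate (complement-matching k) Us Us-unique Us-cover (length-side u)
  , cong (n +_) (sym (+-identityʳ n))
  , refl
  where open Sun n
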